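{- Let $T$ be a $3$-graph with $n$ edges and $2n+1$ vertices. Fix an ordering of the edge set $E(T)$, and for each edge $e\in E(T)$ choose a non-trivial cyclic permutation $\sigma(e)$ of the three-element set $v(e)$ (viewed as a permutation of $V(T)$). Then $T$ is a tree if and only if the product $\sigma(T)=\prod_{e\in E(T)}\sigma(e)$ (taken in the fixed order) is a cyclic permutation of the whole vertex set $V(T)$. In particular, if the product in some order is a cyclic permutation of $V(T)$, then the same is true for any other order.
   Context: A $3$-graph is $G=(V,E,v)$ with $V,E$ finite sets and $v$ a map from $E$ to the set of three-element subsets of $V$. Its topological realization $|G|$ is the graph with a vertex for each element of $V\cup E$ and an edge joining $x\in V$ to $e\in E$ whenever $x\in v(e)$. $G$ is a tree if $|G|$ is connected and simply connected. A cyclic permutation of a set $S$ means a single $|S|$-cycle. -}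

module Defs where

open import Data.Nat using (ℕ; zero; suc; _≤_)
open import Data.Fin using (Fin; zero; suc)
open import Data.Fin.Subset using (Subset; _∈_; _∉_)
open import Data.Fin.Permutation using (Permutation′; _⟨$⟩ʳ_; _∘ₚ_)
import Data.Fin.Permutation as P
open import Data.Sum using (_⊎_; inj₁; inj₂)
open import Data.Product using (Σ; _×_; ∃; ∃-syntax)
open import Data.Empty using (⊥)
open import Data.Unit using (⊤)
open import Data.List using (List; []; _∷_; _++_; length)
open import Data.List.Relation.Unary.Unique.Propositional using (Unique)
open import Relation.Binary.PropositionalEquality using (_≡_)

iter : ∀ {A : Set} → (A → A) → ℕ → A → A
iter f zero x = x
iter f (suc k) x = f (iter f k x)

CyclicOn : ∀ {N} → Subset N → Permutation′ N → Set
CyclicOn {N} S π =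
  (∀ (x : Fin N) → x ∉ S → π ⟨$⟩ʳ x ≡ x) ×
  (Σ (Fin N) λ x → x ∈ S × (∀ (y : Fin N) → y ∈ S → ∃[ k ] iter (π ⟨$⟩ʳ_) k x ≡ y))

IsCyclic : ∀ {N} → Permutation′ N → Set
IsCyclic {N} π = Σ (Fin N) λ x → ∀ (y : Fin N) → ∃[ k ] iter (π ⟨$⟩ʳ_) k x ≡ y

prodP : ∀ {N k} → (Fin k → Permutation′ N) → Permutation′ N
prodP {k = zero} π = P.id
prodP {k = suc k} π = π zero ∘ₚ prodP (λ i → π (suc i))

-- 3-graph with vertex set Fin N and edge set Fin m, v : Fin m → Subset N
-- Topological realization |G|: vertex set Fin N ⊎ Fin m,
-- x joined to e iff x ∈ v e.

Adj : ∀ {N m} → (Fin m → Subset N) → Fin N ⊎ Fin m → Fin N ⊎ Fin m → Set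
Adj v (inj₁ x) (inj₂ e) = x ∈ v e
Adj v (inj₂ e) (inj₁ x) = x ∈ v e
Adj v (inj₁ _) (inj₁ _) = ⊥
Adj v (inj₂ _) (inj₂ _) = ⊥

data Walk {N m} (v : Fin m → Subset N) : Fin N ⊎ Fin m → Fin N ⊎ Fin m → Set where
  here : ∀ {a} → Walk v a a
  step : ∀ {a b c} → Adj v a b → Walk v b c → Walk v a c

Connected : ∀ {N m} → (Fin m → Subset N) → Set
Connected v = ∀ a b → Walk v a b

AdjChain : ∀ {N m} → (Fin m → Subset N) → List (Fin N ⊎ Fin m) → Set
AdjChain v [] = ⊤
AdjChain v (a ∷ []) = ⊤
AdjChain v (a ∷ b ∷ xs) = Adj v a b × AdjChain v (b ∷ xs)

HasCycle : ∀ {N m} → (Fin m → Subset N) → Set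
HasCycle {N} {m} v =
  Σ (Fin N ⊎ Fin m) λ u → Σ (List (Fin N ⊎ Fin m)) λ xs →
    Unique (u ∷ xs) × (3 ≤ length (u ∷ xs)) × AdjChain v (u ∷ xs ++ (u ∷ []))

-- G is a tree: |G| connected and simply connected (for a graph: acyclic)
IsTree : ∀ {N m} → (Fin m → Subset N) → Set
IsTree v = Connected v × (HasCycle v → ⊥)

-- Call an edge redundant if two of its vertices are joined by a walk avoiding it;
-- a cycle in |T| yields one. Counting classes of a labelling constant on edges,
-- each 3-edge merges at most two classes and a redundant edge at most one, so on
-- 2n + 1 vertices a connected T with n edges has no redundant edge.
-- Build σ(T) by multiplying in one 3-cycle σ(e) at a time. Orbits of a product stay
-- inside components, so without redundant edges v(e) meets each orbit of the
-- remaining factors at most once, and multiplying by σ(e) then glues those orbits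
-- along v(e). So σ(T) is cyclic when T is connected and has no redundant edge;
-- conversely, if σ(T) is cyclic then T is connected, hence without redundant edges
-- and in particular acyclic.

module Submission where

open import Defs
open import Data.Nat using (ℕ; zero; suc; _+_; _*_; _≤_; _<_; z≤n; s≤s)
open import Data.Nat.Properties using (≤-refl; ≤-reflexive; ≤-trans; ≤-pred; n<1+n; ≤⇒≯)
open import Data.Nat.Tactic.RingSolver using (solve-∀)
open import Data.Fin using (Fin; zero; suc; toℕ; punchIn; punchOut; _≟_)
open import Data.Fin.Properties using (pigeonhole; punchIn-punchOut; 0≢1+n; suc-injective)
open import Data.Fin.Subset using (Subset; ∣_∣; _∈_; _∉_; Nonempty; inside; outside)
open import Data.Fin.Subset.Properties using (_∈?_)
open import Data.Fin.Permutation using (Permutation′; _⟨$⟩ʳ_; _⟨$⟩ˡ_; _∘ₚ_; inverseʳ)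
open import Data.Vec using ([]; _∷_; here; there)
open import Data.List using (List; []; _∷_; _++_; length; filter; map; allFin)
open import Data.List.Properties using (length-map; length-tabulate; filter-all)
open import Data.List.Membership.Propositional using () renaming (_∈_ to _∈ₗ_)
open import Data.List.Membership.Propositional.Properties using (∈-map⁺)
open import Data.List.Relation.Unary.Any using (here; there)
open import Data.List.Relation.Unary.All as All using (All; []; _∷_)
open import Data.List.Relation.Unary.All.Properties using (all-filter; map⁺)
open import Data.List.Relation.Unary.AllPairs as AllPairs using (AllPairs; []; _∷_)
import Data.List.Relation.Unary.AllPairs.Properties as AllPairs
open import Data.List.Relation.Unary.Unique.Propositional.Properties using (allFin⁺)
open import Data.Product using (_×_; _,_; proj₁; proj₂; ∃-syntax; Σ-syntax)
open import Data.Sum using (_⊎_; inj₁; inj₂)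
open import Data.Unit using (tt)
open import Function using (id; _∘_; Injective; Injection; _⇔_; mk⇔)
open import Function.Properties.Inverse using (↔⇒↣)
open import Level using (0ℓ)
open import Relation.Binary using (Rel; _⇒_)
open import Relation.Binary.Construct.Closure.ReflexiveTransitive
  using (Star; ε; _◅_; _◅◅_; return; fold; reverse; concat; _⋆)
import Relation.Binary.Construct.Closure.ReflexiveTransitive as Star
open import Relation.Binary.PropositionalEquality using (_≡_; _≢_; refl; sym; trans; cong; subst)
open import Relation.Nullary using (¬_; yes; no; ¬?; contradiction)
open import Relation.Unary using (Pred; U; ｛_｝; _∪_; ∁; _⊆_)

⟨$⟩ʳ-injective : ∀ {N} (π : Permutation′ N) → Injective _≡_ _≡_ (π ⟨$⟩ʳ_)
⟨$⟩ʳ-injective π = Injection.injective (↔⇒↣ π)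

Orbit : ∀ {N} → Permutation′ N → Rel (Fin N) 0ℓ
Orbit π = Star (λ x y → π ⟨$⟩ʳ x ≡ y)

module _ {N : ℕ} (π : Permutation′ N) where

  iter⇒orbit : ∀ {x y} → ∃[ k ] iter (π ⟨$⟩ʳ_) k x ≡ y → Orbit π x y
  iter⇒orbit (zero  , refl) = ε
  iter⇒orbit (suc k , refl) = iter⇒orbit (k , refl) ◅◅ return refl

  orbit⇒iter : ∀ {x y} → Orbit π x y → ∃[ k ] iter (π ⟨$⟩ʳ_) k x ≡ y
  orbit⇒iter = go 0 refl
    where
    go : ∀ {x z y} k → iter (π ⟨$⟩ʳ_) k x ≡ z → Orbit π z y → ∃[ k ] iter (π ⟨$⟩ʳ_) k x ≡ y
    go k eq ε          = k , eq
    go k eq (refl ◅ p) = go (suc k) (cong (π ⟨$⟩ʳ_) eq) p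

  private
    orbit-suc-iter : ∀ k x → Orbit π (π ⟨$⟩ʳ x) (iter (π ⟨$⟩ʳ_) (suc k) x)
    orbit-suc-iter zero    x = ε
    orbit-suc-iter (suc k) x = orbit-suc-iter k x ◅◅ return refl

    collision⇒orbit-back : ∀ {x} i j → i < j → iter (π ⟨$⟩ʳ_) i x ≡ iter (π ⟨$⟩ʳ_) j x →
                           Orbit π (π ⟨$⟩ʳ x) x
    collision⇒orbit-back zero    (suc j) _         eq = subst (Orbit π _) (sym eq) (orbit-suc-iter j _)
    collision⇒orbit-back (suc i) (suc j) (s≤s i<j) eq =
      collision⇒orbit-back i j i<j (⟨$⟩ʳ-injective π eq)

  orbit-back : ∀ x → Orbit π (π ⟨$⟩ʳ x) x
  orbit-back x with i , j , i<j , eq ← pigeonhole (n<1+n N) (λ i → iter (π ⟨$⟩ʳ_) (toℕ i) x) =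
    collision⇒orbit-back (toℕ i) (toℕ j) i<j eq

  orbit-sym : ∀ {x y} → Orbit π x y → Orbit π y x
  orbit-sym = concat ∘ reverse (λ { refl → orbit-back _ })

module _ {N : ℕ} {S : Subset N} {σ : Permutation′ N} (cyc : CyclicOn S σ) where

  cyclic-closed : ∀ {x} → x ∈ S → σ ⟨$⟩ʳ x ∈ S
  cyclic-closed {x} x∈S with σ ⟨$⟩ʳ x ∈? S
  ... | yes σx∈S = σx∈S
  ... | no  σx∉S =
    contradiction (subst (_∈ S) (sym (⟨$⟩ʳ-injective σ (proj₁ cyc _ σx∉S))) x∈S) σx∉S

  cyclic-closed⁻ : ∀ {x} → x ∈ S → σ ⟨$⟩ˡ x ∈ S
  cyclic-closed⁻ {x} x∈S with σ ⟨$⟩ˡ x ∈? S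
  ... | yes σ⁻x∈S = σ⁻x∈S
  ... | no  σ⁻x∉S =
    contradiction (subst (_∈ S) (trans (sym (inverseʳ σ)) (proj₁ cyc _ σ⁻x∉S)) x∈S) σ⁻x∉S

  -- σ ∘ₚ P applies σ first, then P.
  module OrbitGlue (P : Permutation′ N)
                   (separated : ∀ {s t} → s ∈ S → t ∈ S → Orbit P s t → s ≡ t) where

    private
      Q : Permutation′ N
      Q = σ ∘ₚ P

      off-support : ∀ {x} → x ∉ S → Q ⟨$⟩ʳ x ≡ P ⟨$⟩ʳ x
      off-support x∉S = cong (P ⟨$⟩ʳ_) (proj₁ cyc _ x∉S)

      follow : ∀ {x y} → Orbit P x y → Orbit Q x y ⊎ ∃[ z ] z ∈ S × Orbit Q x z × Orbit P z y
      follow ε = inj₁ ε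
      follow {x} (refl ◅ p) with x ∈? S
      ... | yes x∈S = inj₂ (x , x∈S , ε , refl ◅ p)
      ... | no  x∉S with follow p
      ...   | inj₁ q                  = inj₁ (off-support x∉S ◅ q)
      ...   | inj₂ (z , z∈S , q , p′) = inj₂ (z , z∈S , off-support x∉S ◅ q , p′)

      -- From P t, Q follows the P-orbit of t until it first meets S, which by
      -- separation happens at t itself.
      returns : ∀ {t} → t ∈ S → Orbit Q (P ⟨$⟩ʳ t) t
      returns t∈S with follow (orbit-back P _)
      ... | inj₁ q                 = q
      ... | inj₂ (z , z∈S , q , p) = subst (Orbit Q _) (separated z∈S t∈S p) q

      σ-orbit⇒Q-orbit : ∀ {s t} → s ∈ S → Orbit σ s t → Orbit Q s t
      σ-orbit⇒Q-orbit s∈S ε          = ε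
      σ-orbit⇒Q-orbit s∈S (refl ◅ p) =
        (refl ◅ returns (cyclic-closed s∈S)) ◅◅ σ-orbit⇒Q-orbit (cyclic-closed s∈S) p

      x₀ : Fin N
      x₀ = proj₁ (proj₂ cyc)

      from-x₀ : ∀ {t} → t ∈ S → Orbit Q x₀ t
      from-x₀ t∈S = let _ , _ , x₀∈S , x₀-reaches = cyc in
        σ-orbit⇒Q-orbit x₀∈S (iter⇒orbit σ (x₀-reaches _ t∈S))

    support-in-one-orbit : ∀ {s t} → s ∈ S → t ∈ S → Orbit (σ ∘ₚ P) s t
    support-in-one-orbit s∈S t∈S = orbit-sym Q (from-x₀ s∈S) ◅◅ from-x₀ t∈S

    private
      P-step⇒Q-orbit : ∀ {x y} → P ⟨$⟩ʳ x ≡ y → Orbit Q x y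
      P-step⇒Q-orbit {x} refl with x ∈? S
      ... | no  x∉S = return (off-support x∉S)
      ... | yes x∈S =
        support-in-one-orbit x∈S (cyclic-closed⁻ x∈S) ◅◅ return (cong (P ⟨$⟩ʳ_) (inverseʳ σ))

    orbit⊆orbit-∘ₚ : Orbit P ⇒ Orbit (σ ∘ₚ P)
    orbit⊆orbit-∘ₚ = P-step⇒Q-orbit ⋆

members : ∀ {N} (p : Subset N) →
          ∃[ xs ] length xs ≡ ∣ p ∣ × All (_∈ p) xs × (∀ {x} → x ∈ p → x ∈ₗ xs)
members [] = [] , refl , [] , λ ()
members (inside ∷ p) with xs , len , all , complete ← members p =
  zero ∷ map suc xs , cong suc (trans (length-map suc xs) len) ,
  here ∷ map⁺ (All.map there all) ,
  λ { here → here refl ; (there x∈p) → there (∈-map⁺ suc (complete x∈p)) }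
members (outside ∷ p) with xs , len , all , complete ← members p =
  map suc xs , trans (length-map suc xs) len ,
  map⁺ (All.map there all) , λ { (there x∈p) → ∈-map⁺ suc (complete x∈p) }

Cover : ∀ {N} → Subset N → Fin N → Fin N → Fin N → Set
Cover p a b d = ∀ {x} → x ∈ p → x ≡ a ⊎ x ≡ b ⊎ x ≡ d

size3-cover : ∀ {N} {p : Subset N} → ∣ p ∣ ≡ 3 → ∃[ a ] ∃[ b ] ∃[ d ] a ∈ p × Cover p a b d
size3-cover {p = p} size with xs , len , all , complete ← members p =
  triple xs (trans len size) all complete
  where
  triple : ∀ xs → length xs ≡ 3 → All (_∈ p) xs → (∀ {x} → x ∈ p → x ∈ₗ xs) →
           ∃[ a ] ∃[ b ] ∃[ d ] a ∈ p × Cover p a b d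
  triple (a ∷ b ∷ d ∷ []) refl (a∈p ∷ _) complete = a , b , d , a∈p , λ x∈p → case (complete x∈p)
    where
    case : ∀ {x} → x ∈ₗ a ∷ b ∷ d ∷ [] → x ≡ a ⊎ x ≡ b ⊎ x ≡ d
    case (here x≡a)                 = inj₁ x≡a
    case (there (here x≡b))         = inj₂ (inj₁ x≡b)
    case (there (there (here x≡d))) = inj₂ (inj₂ x≡d)
  triple []                    () _ _
  triple (_ ∷ [])              () _ _
  triple (_ ∷ _ ∷ [])          () _ _
  triple (_ ∷ _ ∷ _ ∷ _ ∷ _)   () _ _

cover-constant : ∀ {N} {A : Set} {p : Subset N} {a b d} (ℓ : Fin N → A) → Cover p a b d →
                 ℓ b ≡ ℓ a → ℓ d ≡ ℓ a →
                 ∀ {x y} → x ∈ p → y ∈ p → ℓ x ≡ ℓ y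
cover-constant {a = a} ℓ cover b~a d~a x∈p y∈p = trans (to-a x∈p) (sym (to-a y∈p))
  where
  to-a : ∀ {x} → x ∈ _ → ℓ x ≡ ℓ a
  to-a x∈p with cover x∈p
  ... | inj₁ refl        = refl
  ... | inj₂ (inj₁ refl) = b~a
  ... | inj₂ (inj₂ refl) = d~a

cover-coincidence : ∀ {N} {A : Set} {p : Subset N} {a b d s t} (ℓ : Fin N → A) → Cover p a b d →
                    s ∈ p → t ∈ p → s ≢ t → ℓ s ≡ ℓ t → ℓ a ≡ ℓ b ⊎ ℓ a ≡ ℓ d ⊎ ℓ b ≡ ℓ d
cover-coincidence ℓ cover s∈p t∈p s≢t eq with cover s∈p | cover t∈p
... | inj₁ refl        | inj₁ refl        = contradiction refl s≢t
... | inj₁ refl        | inj₂ (inj₁ refl) = inj₁ eq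
... | inj₁ refl        | inj₂ (inj₂ refl) = inj₂ (inj₁ eq)
... | inj₂ (inj₁ refl) | inj₁ refl        = inj₁ (sym eq)
... | inj₂ (inj₁ refl) | inj₂ (inj₁ refl) = contradiction refl s≢t
... | inj₂ (inj₁ refl) | inj₂ (inj₂ refl) = inj₂ (inj₂ eq)
... | inj₂ (inj₂ refl) | inj₁ refl        = inj₂ (inj₁ (sym eq))
... | inj₂ (inj₂ refl) | inj₂ (inj₁ refl) = inj₂ (inj₂ (sym eq))
... | inj₂ (inj₂ refl) | inj₂ (inj₂ refl) = contradiction refl s≢t

module _ {N : ℕ} where

  record Labelling (r : ℕ) : Set where
    field
      label    : Fin N → Fin N
      reps     : List (Fin N)
      distinct : AllPairs (λ x y → label x ≢ label y) reps
      r≤#reps  : r ≤ length reps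

  open Labelling public

  Coarser : ∀ {r r′} → Labelling r → Labelling r′ → Set
  Coarser L L′ = ∀ {x y} → label L x ≡ label L y → label L′ x ≡ label L′ y

  discrete : ∀ {r} → r ≤ N → Labelling r
  discrete r≤N = record
    { label    = id
    ; reps     = allFin N
    ; distinct = allFin⁺ N
    ; r≤#reps  = ≤-trans r≤N (≤-reflexive (sym (length-tabulate id)))
    }

  constant⇒≤1 : ∀ {r} (L : Labelling r) → (∀ x y → label L x ≡ label L y) → r ≤ 1
  constant⇒≤1 L constant with reps L | distinct L | r≤#reps L
  ... | []        | _               | r≤0 = ≤-trans r≤0 z≤n
  ... | _ ∷ []    | _               | r≤1 = r≤1
  ... | x ∷ y ∷ _ | (x≢y ∷ _) ∷ _   | _   = contradiction (constant x y) x≢y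

  private
    allPairs-restrict : ∀ {P : Pred (Fin N) 0ℓ} {R S : Rel (Fin N) 0ℓ} →
                        (∀ {x y} → P x → P y → R x y → S x y) →
                        ∀ {xs} → All P xs → AllPairs R xs → AllPairs S xs
    allPairs-restrict f []         []         = []
    allPairs-restrict f (px ∷ pxs) (rx ∷ rxs) =
      All.zipWith (λ (py , r) → f px py r) (pxs , rx) ∷ allPairs-restrict f pxs rxs

    -- As the labels in xs are distinct, at most one element lies in class l.
    length-drop-class : (ℓ : Fin N → Fin N) (l : Fin N) →
                        ∀ {xs} → AllPairs (λ x y → ℓ x ≢ ℓ y) xs →
                        length xs ≤ suc (length (filter (λ x → ¬? (ℓ x ≟ l)) xs))
    length-drop-class ℓ l [] = z≤n
    length-drop-class ℓ l {x ∷ xs} (x≢xs ∷ d) with ℓ x ≟ l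
    ... | yes ℓx≡l = ≤-reflexive (cong (suc ∘ length) (sym (filter-all (λ x → ¬? (ℓ x ≟ l))
                       (All.map (λ ℓx≢ℓy ℓy≡l → ℓx≢ℓy (trans ℓx≡l (sym ℓy≡l))) x≢xs))))
    ... | no  _    = s≤s (length-drop-class ℓ l d)

  glue : ∀ {r} (L : Labelling (suc r)) x y →
         Σ[ L′ ∈ Labelling r ] Coarser L L′ × label L′ x ≡ label L′ y
  glue L x y = L′ , cong relabel , trans relabel-ℓx (sym relabel-ℓy)
    where
    ℓ = label L

    relabel : Fin N → Fin N
    relabel l with l ≟ ℓ y
    ... | yes _ = ℓ x
    ... | no  _ = l

    relabel-ℓx : relabel (ℓ x) ≡ ℓ x
    relabel-ℓx with ℓ x ≟ ℓ y
    ... | yes _ = refl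
    ... | no  _ = refl

    relabel-ℓy : relabel (ℓ y) ≡ ℓ x
    relabel-ℓy with ℓ y ≟ ℓ y
    ... | yes _  = refl
    ... | no  ne = contradiction refl ne

    relabel-off : ∀ {l} → l ≢ ℓ y → relabel l ≡ l
    relabel-off {l} l≢ℓy with l ≟ ℓ y
    ... | yes l≡ℓy = contradiction l≡ℓy l≢ℓy
    ... | no  _    = refl

    keep? = λ u → ¬? (ℓ u ≟ ℓ y)

    L′ : Labelling _
    L′ = record
      { label    = relabel ∘ ℓ
      ; reps     = filter keep? (reps L)
      ; distinct = allPairs-restrict
          (λ u∉ w∉ ℓu≢ℓw eq → ℓu≢ℓw (trans (sym (relabel-off u∉)) (trans eq (relabel-off w∉))))
          (all-filter keep? (reps L)) (AllPairs.filter⁺ keep? (distinct L))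
      ; r≤#reps  = ≤-pred (≤-trans (r≤#reps L) (length-drop-class ℓ (ℓ y) (distinct L)))
      }

  glue-triple : ∀ {r} (L : Labelling (2 + r)) a b d →
                Σ[ L′ ∈ Labelling r ] Coarser L L′ × label L′ b ≡ label L′ a × label L′ d ≡ label L′ a
  glue-triple L a b d with L₁ , L≤L₁ , a~b ← glue L a b with L₂ , L₁≤L₂ , a~d ← glue L₁ a d =
    L₂ , L₁≤L₂ ∘ L≤L₁ , sym (L₁≤L₂ a~b) , sym a~d

  glue-triple-coinciding : ∀ {r} (L : Labelling (suc r)) {a b d} →
    let ℓ = label L in ℓ a ≡ ℓ b ⊎ ℓ a ≡ ℓ d ⊎ ℓ b ≡ ℓ d →
    Σ[ L′ ∈ Labelling r ] Coarser L L′ × label L′ b ≡ label L′ a × label L′ d ≡ label L′ a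
  glue-triple-coinciding L {a} {b} {d} (inj₁ a~b) with L′ , L≤L′ , a~d ← glue L a d =
    L′ , L≤L′ , sym (L≤L′ a~b) , sym a~d
  glue-triple-coinciding L {a} {b} {d} (inj₂ (inj₁ a~d)) with L′ , L≤L′ , a~b ← glue L a b =
    L′ , L≤L′ , sym a~b , sym (L≤L′ a~d)
  glue-triple-coinciding L {a} {b} {d} (inj₂ (inj₂ b~d)) with L′ , L≤L′ , a~b ← glue L a b =
    L′ , L≤L′ , sym a~b , trans (sym (L≤L′ b~d)) (sym a~b)

2*[1+k]+r≡2*k+[2+r] : ∀ k r → 2 * suc k + r ≡ 2 * k + (2 + r)
2*[1+k]+r≡2*k+[2+r] = solve-∀

1+2*[1+k]≡2*k+3 : ∀ k → suc (2 * suc k) ≡ 2 * k + 3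
1+2*[1+k]≡2*k+3 = solve-∀

module _ {N n : ℕ} (v : Fin n → Subset N) where

  Adjacent : Pred (Fin n) 0ℓ → Rel (Fin N) 0ℓ
  Adjacent ok x y = ∃[ e ] ok e × x ∈ v e × y ∈ v e

  Joined : Pred (Fin n) 0ℓ → Rel (Fin N) 0ℓ
  Joined ok = Star (Adjacent ok)

  InRange : ∀ {k} → (Fin k → Fin n) → Pred (Fin n) 0ℓ
  InRange h e = ∃[ i ] h i ≡ e

  RedundantEdge : Set
  RedundantEdge = ∃[ e ] ∃[ s ] ∃[ t ] s ≢ t × s ∈ v e × t ∈ v e × Joined (∁ ｛ e ｝) s t

  joined-mono : ∀ {ok ok′} → ok ⊆ ok′ → Joined ok ⇒ Joined ok′
  joined-mono ok⊆ok′ = Star.map (λ (e , o , x∈e , y∈e) → e , ok⊆ok′ o , x∈e , y∈e)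

  joined-sym : ∀ {ok x y} → Joined ok x y → Joined ok y x
  joined-sym = reverse (λ (e , o , x∈e , y∈e) → e , o , y∈e , x∈e)

  walk⇒joined : ∀ {x y} → Walk v (inj₁ x) (inj₁ y) → Joined U x y
  walk⇒joined here = ε
  walk⇒joined (step {b = inj₂ e} x∈e (step {b = inj₁ z} z∈e w)) = (e , tt , x∈e , z∈e) ◅ walk⇒joined w
  walk⇒joined (step {b = inj₁ _} () _)
  walk⇒joined (step {b = inj₂ _} _ (step {b = inj₂ _} () _))

  joined⇒walk : ∀ {ok x y} → Joined ok x y → Walk v (inj₁ x) (inj₁ y)
  joined⇒walk ε                           = here
  joined⇒walk ((e , _ , x∈e , z∈e) ◅ p) = step {b = inj₂ e} x∈e (step z∈e (joined⇒walk p))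

  private
    _++ʷ_ : ∀ {a b c} → Walk v a b → Walk v b c → Walk v a c
    here       ++ʷ w′ = w′
    step adj w ++ʷ w′ = step adj (w ++ʷ w′)

  rooted⇒connected : ∀ {ok x₀} → (∀ e → Nonempty (v e)) → (∀ y → Joined ok x₀ y) → Connected v
  rooted⇒connected {x₀ = x₀} nonempty reach a b = to-root a ++ʷ from-root b
    where
    from-root : ∀ b → Walk v (inj₁ x₀) b
    from-root (inj₁ y) = joined⇒walk (reach y)
    from-root (inj₂ e) = from-root (inj₁ (proj₁ (nonempty e))) ++ʷ step (proj₂ (nonempty e)) here

    to-root : ∀ a → Walk v a (inj₁ x₀)
    to-root (inj₁ y) = joined⇒walk (joined-sym (reach y))
    to-root (inj₂ e) = step (proj₂ (nonempty e)) (to-root (inj₁ (proj₁ (nonempty e))))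

  private
    Node = Fin N ⊎ Fin n

    chain⇒joined : ∀ {e} s t (ws : List Node) → AdjChain v (inj₁ s ∷ ws ++ inj₁ t ∷ []) →
                   All (inj₂ e ≢_) ws → Joined (∁ ｛ e ｝) s t
    chain⇒joined s t []                      (() , _)
    chain⇒joined s t (inj₁ _ ∷ _)            (() , _)
    chain⇒joined s t (inj₂ g ∷ [])           (s∈g , t∈g , _) (e≢g ∷ _) =
      return (g , e≢g ∘ cong inj₂ , s∈g , t∈g)
    chain⇒joined s t (inj₂ _ ∷ inj₂ _ ∷ _)   (_ , () , _)
    chain⇒joined s t (inj₂ g ∷ inj₁ z ∷ ws)  (s∈g , z∈g , chain) (e≢g ∷ _ ∷ e∉ws) =
      (g , e≢g ∘ cong inj₂ , s∈g , z∈g) ◅ chain⇒joined z t ws chain e∉ws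

    chain-to-edge : ∀ {e} s (ws : List Node) → AdjChain v (inj₁ s ∷ ws ++ inj₂ e ∷ []) →
                    All (inj₂ e ≢_) ws →
                    ∃[ t ] t ∈ v e × Joined (∁ ｛ e ｝) s t × (ws ≡ [] × t ≡ s ⊎ inj₁ t ∈ₗ ws)
    chain-to-edge s []                     (s∈e , _) _ = s , s∈e , ε , inj₁ (refl , refl)
    chain-to-edge s (inj₁ _ ∷ _)           (() , _)
    chain-to-edge s (inj₂ _ ∷ [])          (_ , () , _)
    chain-to-edge s (inj₂ _ ∷ inj₂ _ ∷ _)  (_ , () , _)
    chain-to-edge s (inj₂ g ∷ inj₁ z ∷ ws) (s∈g , z∈g , chain) (e≢g ∷ _ ∷ e∉ws)
      with t , t∈e , path , t-at ← chain-to-edge z ws chain e∉ws =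
      t , t∈e , (g , e≢g ∘ cong inj₂ , s∈g , z∈g) ◅ path , inj₂ (later t-at)
      where
      later : ws ≡ [] × t ≡ z ⊎ inj₁ t ∈ₗ ws → inj₁ t ∈ₗ inj₂ g ∷ inj₁ z ∷ ws
      later (inj₁ (_ , refl)) = there (here refl)
      later (inj₂ t∈ws) = there (there t∈ws)

  cycle⇒redundant : HasCycle v → RedundantEdge
  cycle⇒redundant (inj₁ x , inj₂ e ∷ inj₁ a ∷ ws , (_ ∷ x≢a ∷ _) ∷ (_ ∷ e∉ws) ∷ _ , _ , x∈e , a∈e , chain) =
    e , a , x , x≢a ∘ cong inj₁ ∘ sym , a∈e , x∈e , chain⇒joined a x ws chain e∉ws
  cycle⇒redundant (inj₂ e , inj₁ a ∷ w ∷ ws , (_ ∷ e∉ws) ∷ (a∉ws ∷ _) , _ , a∈e , chain)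
    with chain-to-edge a (w ∷ ws) chain e∉ws
  ... | t , t∈e , path , inj₂ t∈ws = e , a , t , a≢t , a∈e , t∈e , path
    where a≢t = λ a≡t → All.lookup a∉ws t∈ws (cong inj₁ a≡t)
  cycle⇒redundant (inj₁ _ , []                    , _ , s≤s () , _)
  cycle⇒redundant (inj₁ _ , inj₁ _ ∷ _            , _ , _ , () , _)
  cycle⇒redundant (inj₁ _ , inj₂ _ ∷ []           , _ , s≤s (s≤s ()) , _)
  cycle⇒redundant (inj₁ _ , inj₂ _ ∷ inj₂ _ ∷ _   , _ , _ , _ , () , _)
  cycle⇒redundant (inj₂ _ , []                    , _ , s≤s () , _)
  cycle⇒redundant (inj₂ _ , inj₂ _ ∷ _            , _ , _ , () , _)
  cycle⇒redundant (inj₂ _ , inj₁ _ ∷ []           , _ , s≤s (s≤s ()) , _)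

  Respects : ∀ {r} → Pred (Fin n) 0ℓ → Labelling r → Set
  Respects ok L = ∀ {x y} → Adjacent ok x y → label L x ≡ label L y

  respects-joined : ∀ {r ok} {L : Labelling r} → Respects ok L →
                    ∀ {x y} → Joined ok x y → label L x ≡ label L y
  respects-joined resp = fold _ (λ adj eq → trans (resp adj) eq) refl

  private
    respects-extend : ∀ {r r′ ok e} {L : Labelling r} {L′ : Labelling r′} → Coarser L L′ →
                      (∀ {x y} → x ∈ v e → y ∈ v e → label L′ x ≡ label L′ y) →
                      Respects ok L → Respects (｛ e ｝ ∪ ok) L′
    respects-extend L≤L′ constant resp (_ , inj₁ refl , x∈e , y∈e) = constant x∈e y∈e
    respects-extend L≤L′ constant resp (g , inj₂ o    , x∈g , y∈g) = L≤L′ (resp (g , o , x∈g , y∈g))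

  add-edge : ∀ {r ok e} → ∣ v e ∣ ≡ 3 → (L : Labelling (2 + r)) → Respects ok L →
             Σ[ L′ ∈ Labelling r ] Respects (｛ e ｝ ∪ ok) L′
  add-edge size L resp
    with a , b , d , _ , cover ← size3-cover size
    with L′ , L≤L′ , b~a , d~a ← glue-triple L a b d =
    L′ , respects-extend {L = L} {L′} L≤L′ (cover-constant (label L′) cover b~a d~a) resp

  add-redundant-edge : ∀ {r ok e s t} → ∣ v e ∣ ≡ 3 → s ≢ t → s ∈ v e → t ∈ v e →
                       (L : Labelling (suc r)) → Respects ok L → label L s ≡ label L t →
                       Σ[ L′ ∈ Labelling r ] Respects (｛ e ｝ ∪ ok) L′
  add-redundant-edge size s≢t s∈e t∈e L resp s~t
    with a , b , d , _ , cover ← size3-cover size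
    with L′ , L≤L′ , b~a , d~a ←
           glue-triple-coinciding L (cover-coincidence (label L) cover s∈e t∈e s≢t s~t) =
    L′ , respects-extend {L = L} {L′} L≤L′ (cover-constant (label L′) cover b~a d~a) resp

  edges-labelling : ∀ {r} → (∀ e → ∣ v e ∣ ≡ 3) → ∀ k (h : Fin k → Fin n) → 2 * k + r ≤ N →
                    Σ[ L ∈ Labelling r ] Respects (InRange h) L
  edges-labelling size zero    h r≤N = discrete r≤N , λ { (_ , (() , _) , _) }
  edges-labelling {r} size (suc k) h bound
    with L , resp ← edges-labelling {2 + r} size k (h ∘ suc)
                      (subst (_≤ N) (2*[1+k]+r≡2*k+[2+r] k r) bound)
    with L′ , resp′ ← add-edge (size (h zero)) L resp =
    L′ , resp′ ∘ split
    where
    split : ∀ {x y} → Adjacent (InRange h) x y → Adjacent (｛ h zero ｝ ∪ InRange (h ∘ suc)) x y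
    split (g , (zero  , refl) , x∈g , y∈g) = g , inj₁ refl , x∈g , y∈g
    split (g , (suc i , refl) , x∈g , y∈g) = g , inj₂ (i , refl) , x∈g , y∈g

-- Without e, the other n - 1 edges leave at least three classes; e then merges
-- at most one more, since two of its vertices were already joined.
connected⇒¬redundant : ∀ {N n} (v : Fin n → Subset N) → (∀ e → ∣ v e ∣ ≡ 3) → 2 * n < N →
                       (∀ x y → Joined v U x y) → ¬ RedundantEdge v
connected⇒¬redundant {N} {suc n′} v size 2n<N connected (e , s , t , s≢t , s∈e , t∈e , path) =
  ≤⇒≯ (constant⇒≤1 L′ λ x y →
         respects-joined v {L = L′} resp′ (joined-mono v everything (connected x y)))
      (s≤s (s≤s z≤n))
  where
  others : ∁ ｛ e ｝ ⊆ InRange v (punchIn e)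
  others e≢g = punchOut e≢g , punchIn-punchOut e≢g

  everything : U ⊆ ｛ e ｝ ∪ InRange v (punchIn e)
  everything {g} _ with e ≟ g
  ... | yes e≡g = inj₁ e≡g
  ... | no  e≢g = inj₂ (others e≢g)

  3+2n′≤N : 2 * n′ + 3 ≤ N
  3+2n′≤N = subst (_≤ N) (1+2*[1+k]≡2*k+3 n′) 2n<N

  without-e : Σ[ L ∈ Labelling 3 ] Respects v (InRange v (punchIn e)) L
  without-e = edges-labelling v size n′ (punchIn e) 3+2n′≤N

  L = proj₁ without-e
  resp = proj₂ without-e

  with-e : Σ[ L′ ∈ Labelling 2 ] Respects v (｛ e ｝ ∪ InRange v (punchIn e)) L′
  with-e = add-redundant-edge v (size e) s≢t s∈e t∈e L resp
             (respects-joined v {L = L} resp (joined-mono v others path))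

  L′ = proj₁ with-e
  resp′ = proj₂ with-e

module _ {N n : ℕ} (v : Fin n → Subset N) (σ : Fin n → Permutation′ N)
         (cyclic : ∀ e → CyclicOn (v e) (σ e)) where

  private
    product-step⇒joined : ∀ {k} (h : Fin k → Fin n) {x y} →
                  prodP (λ i → σ (h i)) ⟨$⟩ʳ x ≡ y → Joined v (InRange v h) x y
    product-step⇒joined {zero}  h refl = ε
    product-step⇒joined {suc k} h {x} refl =
      first ◅◅ joined-mono v {ok = InRange v (h ∘ suc)} (λ (i , hᵢ≡g) → suc i , hᵢ≡g)
                             (product-step⇒joined (h ∘ suc) refl)
      where
      first : Joined v (InRange v h) x (σ (h zero) ⟨$⟩ʳ x)
      first with x ∈? v (h zero)
      ... | yes x∈e = return (h zero , (zero , refl) , x∈e ,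
                              cyclic-closed {S = v (h zero)} {σ (h zero)} (cyclic (h zero)) x∈e)
      ... | no  x∉e = subst (Joined v (InRange v h) x) (sym (proj₁ (cyclic (h zero)) x x∉e)) ε

  orbit⇒joined : ∀ {k} (h : Fin k → Fin n) → Orbit (prodP (λ i → σ (h i))) ⇒ Joined v (InRange v h)
  orbit⇒joined h = product-step⇒joined h ⋆

  first-edge-separated : ∀ {k} (h : Fin (suc k) → Fin n) → Injective _≡_ _≡_ h → ¬ RedundantEdge v →
                         ∀ {s t} → s ∈ v (h zero) → t ∈ v (h zero) →
                         Orbit (prodP (λ i → σ (h (suc i)))) s t → s ≡ t
  first-edge-separated h injective ¬redundant {s} {t} s∈e t∈e orbit with s ≟ t
  ... | yes s≡t = s≡t
  ... | no  s≢t = contradiction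
        (h zero , s , t , s≢t , s∈e , t∈e , joined-mono v avoids (orbit⇒joined (h ∘ suc) orbit))
        ¬redundant
    where
    avoids : InRange v (h ∘ suc) ⊆ ∁ ｛ h zero ｝
    avoids (i , refl) h₀≡hᵢ₊₁ = 0≢1+n (injective h₀≡hᵢ₊₁)

  private
    adjacent⇒orbit : ∀ {k} (h : Fin k → Fin n) → Injective _≡_ _≡_ h → ¬ RedundantEdge v →
                     Adjacent v (InRange v h) ⇒ Orbit (prodP (λ i → σ (h i)))
    adjacent⇒orbit {zero}  h _ _ (_ , (() , _) , _)
    adjacent⇒orbit {suc k} h injective ¬redundant = glued
      where
      open OrbitGlue {S = v (h zero)} {σ (h zero)} (cyclic (h zero)) (prodP (λ i → σ (h (suc i))))
                     (first-edge-separated h injective ¬redundant)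

      glued : Adjacent v (InRange v h) ⇒ Orbit (prodP (λ i → σ (h i)))
      glued (g , (zero  , refl) , x∈g , y∈g) = support-in-one-orbit x∈g y∈g
      glued (g , (suc i , refl) , x∈g , y∈g) = orbit⊆orbit-∘ₚ
        (adjacent⇒orbit (h ∘ suc) (suc-injective ∘ injective) ¬redundant (g , (i , refl) , x∈g , y∈g))

  joined⇒orbit : ∀ {k} (h : Fin k → Fin n) → Injective _≡_ _≡_ h → ¬ RedundantEdge v →
                 Joined v (InRange v h) ⇒ Orbit (prodP (λ i → σ (h i)))
  joined⇒orbit h injective ¬redundant = adjacent⇒orbit h injective ¬redundant ⋆

proposition3p4 : (n : ℕ) (v : Fin n → Subset (suc (2 * n)))
                 → (∀ e → ∣ v e ∣ ≡ 3)
                 → (ord : Permutation′ n)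
                 → (σ : Fin n → Permutation′ (suc (2 * n)))
                 → (∀ e → CyclicOn (v e) (σ e))
                 → IsTree v ⇔ IsCyclic (prodP (λ i → σ (ord ⟨$⟩ʳ i)))
proposition3p4 n v size ord σ cyclic = mk⇔ tree⇒cyclic cyclic⇒tree
  where
  π : Permutation′ (suc (2 * n))
  π = prodP (λ i → σ (ord ⟨$⟩ʳ i))

  all-edges : U ⊆ InRange v (ord ⟨$⟩ʳ_)
  all-edges {e} _ = ord ⟨$⟩ˡ e , inverseʳ ord

  ¬redundant : Connected v → ¬ RedundantEdge v
  ¬redundant connected =
    connected⇒¬redundant v size ≤-refl λ x y → walk⇒joined v (connected (inj₁ x) (inj₁ y))

  tree⇒cyclic : IsTree v → IsCyclic π
  tree⇒cyclic (connected , _) = zero , λ y → orbit⇒iter π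
    (joined⇒orbit v σ cyclic _ (⟨$⟩ʳ-injective ord) (¬redundant connected)
      (joined-mono v all-edges (walk⇒joined v (connected (inj₁ zero) (inj₁ y)))))

  cyclic⇒tree : IsCyclic π → IsTree v
  cyclic⇒tree (x₀ , reach) = connected , ¬redundant connected ∘ cycle⇒redundant v
    where
    connected : Connected v
    connected = rooted⇒connected v (λ e → let a , _ , _ , a∈e , _ = size3-cover (size e) in a , a∈e)
                  λ y → orbit⇒joined v σ cyclic (ord ⟨$⟩ʳ_) (iter⇒orbit π (reach y))
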